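{- Every SD-tree having exactly one $S$-node is isomorphic to some ladder SD-tree.
   Context: A summation tree is a rooted full binary tree (every node has $0$ or $2$ children). Two summation trees are isomorphic if one can be obtained from the other by a finite sequence of swaps of the two children (with their subtrees) of internal nodes. An SD-tree is a summation tree in which each internal node is labelled $S$ ($S$-node) if its two children have the same number of descendant leaves, and $D$ otherwise. The ladder SD-tree with $n\ge 2$ leaves is the tree of $((\cdots((x_1+x_2)+x_3)+\cdots)+x_n)$: for $n=2$ a root with two leaf children, and for $n>2$ a root whose children are a single leaf and the ladder tree with $n-1$ leaves. -}

module Defs where

open import Data.Nat using (ℕ; zero; suc; _+_; _≤_)
open import Relation.Binary.Construct.Closure.ReflexiveTransitive using (Star)

-- Summation trees: rooted full binary trees (unlabelled leaves).
data Tree : Set where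
  leaf : Tree
  node : Tree → Tree → Tree

leaves : Tree → ℕ
leaves leaf       = 1
leaves (node l r) = leaves l + leaves r

data Swap : Tree → Tree → Set where
  here  : ∀ l r → Swap (node l r) (node r l)
  left  : ∀ {l l′} r → Swap l l′ → Swap (node l r) (node l′ r)
  right : ∀ l {r r′} → Swap r r′ → Swap (node l r) (node l r′)

_≅_ : Tree → Tree → Set
_≅_ = Star Swap

-- SD-labelling: an internal node is an S-node iff its two children have the
-- same number of leaves (otherwise a D-node).  Number of S-nodes:
open import Data.Nat.Properties using (_≟_)
open import Relation.Nullary using (yes; no)

isS : Tree → Tree → ℕ
isS l r with leaves l ≟ leaves r
... | yes _ = 1
... | no  _ = 0

numS : Tree → ℕ
numS leaf       = 0
numS (node l r) = isS l r + numS l + numS r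

-- Ladder tree with n ≥ 2 leaves: ((…((x1+x2)+x3)+…)+xn).
-- ladder k has k + 2 leaves; for n > 2 the root's children are a leaf and the
-- ladder with n-1 leaves (order of children is irrelevant up to isomorphism).
ladder : ℕ → Tree
ladder zero    = node leaf leaf
ladder (suc k) = node (ladder k) leaf

-- A bottom-most internal node has two leaf children and is therefore an S-node, so
-- every internal subtree contains an S-node.  With exactly one S-node, no internal
-- node can have two internal children; hence along the spine from the root every
-- internal node has a leaf child, and after swapping that leaf to the right the
-- tree is a ladder.

module Submission where

open import Defs
open import Data.Empty using (⊥-elim)
open import Data.Nat using (suc; _+_; _≤_; _<_; s≤s; z≤n)
open import Data.Nat.Properties
  using (_≟_; +-assoc; +-identityʳ; +-mono-≤; ≤-trans; m≤n+m; m≤m+n; <⇒≢; >⇒≢)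
open import Data.Product using (∃-syntax; _,_)
open import Relation.Binary.Construct.Closure.ReflexiveTransitive using (ε; _◅_; gmap)
open import Relation.Binary.PropositionalEquality using (_≡_; _≢_; refl; sym; trans; cong)
open import Relation.Nullary using (yes; no)

node-congˡ : ∀ {l l′} r → l ≅ l′ → node l r ≅ node l′ r
node-congˡ r = gmap (λ l → node l r) (left r)

1≤leaves : ∀ t → 1 ≤ leaves t
1≤leaves leaf       = s≤s z≤n
1≤leaves (node l r) = ≤-trans (1≤leaves l) (m≤m+n (leaves l) (leaves r))

1<leaves-node : ∀ l r → 1 < leaves (node l r)
1<leaves-node l r = +-mono-≤ (1≤leaves l) (1≤leaves r)

isS-≢ : ∀ l r → leaves l ≢ leaves r → isS l r ≡ 0
isS-≢ l r l≢r with leaves l ≟ leaves r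
... | yes l≡r = ⊥-elim (l≢r l≡r)
... | no  _   = refl

numS-leaf-node : ∀ a b → numS (node leaf (node a b)) ≡ numS (node a b)
numS-leaf-node a b = cong (λ s → s + 0 + numS (node a b)) (isS-≢ leaf (node a b) (<⇒≢ (1<leaves-node a b)))

numS-node-leaf : ∀ a b → numS (node (node a b) leaf) ≡ numS (node a b)
numS-node-leaf a b = trans
  (cong (λ s → s + numS (node a b) + 0) (isS-≢ (node a b) leaf (>⇒≢ (1<leaves-node a b))))
  (+-identityʳ (numS (node a b)))

numS-children : ∀ l r → numS l + numS r ≤ numS (node l r)
numS-children l r rewrite +-assoc (isS l r) (numS l) (numS r) = m≤n+m _ (isS l r)

1≤numS-node : ∀ l r → 1 ≤ numS (node l r)
1≤numS-node leaf       leaf       = s≤s z≤n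
1≤numS-node leaf       (node a b) =
  ≤-trans (1≤numS-node a b) (≤-trans (m≤n+m _ (numS leaf)) (numS-children leaf (node a b)))
1≤numS-node (node a b) r          =
  ≤-trans (1≤numS-node a b) (≤-trans (m≤m+n _ (numS r)) (numS-children (node a b) r))

2≤numS-node-node : ∀ a b c d → 2 ≤ numS (node (node a b) (node c d))
2≤numS-node-node a b c d =
  ≤-trans (+-mono-≤ (1≤numS-node a b) (1≤numS-node c d)) (numS-children (node a b) (node c d))

lemma6 : (t : Tree) → numS t ≡ 1 → ∃[ n ] (t ≅ ladder n)
lemma6 leaf ()
lemma6 (node leaf leaf) _ = 0 , ε
lemma6 (node leaf t@(node a b)) one-S with lemma6 t (trans (sym (numS-leaf-node a b)) one-S)
... | n , t≅ladder = suc n , here leaf t ◅ node-congˡ leaf t≅ladder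
lemma6 (node t@(node a b) leaf) one-S with lemma6 t (trans (sym (numS-node-leaf a b)) one-S)
... | n , t≅ladder = suc n , node-congˡ leaf t≅ladder
lemma6 (node (node a b) (node c d)) one-S = ⊥-elim (<⇒≢ (2≤numS-node-node a b c d) (sym one-S))
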